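{- Let $A$ be a finite graph which is $C_4$-free (there is no injective homomorphism from the $4$-cycle $C_4$ into $A$), has diameter $2$, and has no dominating vertex. Then there is an edge of $A$ that is not contained in any $3$-cycle of $A$.
   Context: A vertex $v$ of a graph $A$ is dominating if $v$ is adjacent to every vertex of $A\setminus\{v\}$. -}

module Defs where

open import Data.Nat using (ℕ; suc)
open import Data.Fin using (Fin; zero; suc)
open import Data.Bool using (Bool; true; false; T)
open import Data.Product using (Σ; ∃; _×_; _,_)
open import Data.Sum using (_⊎_)
open import Relation.Binary.PropositionalEquality using (_≡_)
open import Relation.Nullary using (¬_)
open import Function.Definitions using (Injective)

record Graph (n : ℕ) : Set where
  field
    adj       : Fin n → Fin n → Bool
    adj-sym   : ∀ u v → adj u v ≡ adj v u
    adj-irrefl : ∀ v → adj v v ≡ false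

open Graph public

_∼[_]_ : {n : ℕ} → Fin n → Graph n → Fin n → Set
u ∼[ G ] v = T (adj G u v)

IsHom : {m n : ℕ} → Graph m → Graph n → (Fin m → Fin n) → Set
IsHom H G f = ∀ u v → u ∼[ H ] v → f u ∼[ G ] f v

c4adj : Fin 4 → Fin 4 → Bool
c4adj zero (suc zero) = true
c4adj (suc zero) zero = true
c4adj (suc zero) (suc (suc zero)) = true
c4adj (suc (suc zero)) (suc zero) = true
c4adj (suc (suc zero)) (suc (suc (suc zero))) = true
c4adj (suc (suc (suc zero))) (suc (suc zero)) = true
c4adj (suc (suc (suc zero))) zero = true
c4adj zero (suc (suc (suc zero))) = true
c4adj _ _ = false

C₄ : Graph 4
C₄ = record { adj = c4adj ; adj-sym = sym' ; adj-irrefl = irr }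
  where
  sym' : ∀ u v → c4adj u v ≡ c4adj v u
  sym' zero zero = _≡_.refl
  sym' zero (suc zero) = _≡_.refl
  sym' zero (suc (suc zero)) = _≡_.refl
  sym' zero (suc (suc (suc zero))) = _≡_.refl
  sym' (suc zero) zero = _≡_.refl
  sym' (suc zero) (suc zero) = _≡_.refl
  sym' (suc zero) (suc (suc zero)) = _≡_.refl
  sym' (suc zero) (suc (suc (suc zero))) = _≡_.refl
  sym' (suc (suc zero)) zero = _≡_.refl
  sym' (suc (suc zero)) (suc zero) = _≡_.refl
  sym' (suc (suc zero)) (suc (suc zero)) = _≡_.refl
  sym' (suc (suc zero)) (suc (suc (suc zero))) = _≡_.refl
  sym' (suc (suc (suc zero))) zero = _≡_.refl
  sym' (suc (suc (suc zero))) (suc zero) = _≡_.refl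
  sym' (suc (suc (suc zero))) (suc (suc zero)) = _≡_.refl
  sym' (suc (suc (suc zero))) (suc (suc (suc zero))) = _≡_.refl
  irr : ∀ v → c4adj v v ≡ false
  irr zero = _≡_.refl
  irr (suc zero) = _≡_.refl
  irr (suc (suc zero)) = _≡_.refl
  irr (suc (suc (suc zero))) = _≡_.refl

C4Free : {n : ℕ} → Graph n → Set
C4Free {n} G = ¬ (Σ (Fin 4 → Fin n) λ f → Injective _≡_ _≡_ f × IsHom C₄ G f)

DistLe2 : {n : ℕ} → Graph n → Fin n → Fin n → Set
DistLe2 G u v = u ≡ v ⊎ u ∼[ G ] v ⊎ ∃ λ w → u ∼[ G ] w × w ∼[ G ] v

Dist2 : {n : ℕ} → Graph n → Fin n → Fin n → Set
Dist2 G u v = ¬ (u ≡ v) × ¬ (u ∼[ G ] v) × ∃ λ w → u ∼[ G ] w × w ∼[ G ] v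

Diameter2 : {n : ℕ} → Graph n → Set
Diameter2 G = (∀ u v → DistLe2 G u v) × (∃ λ u → ∃ λ v → Dist2 G u v)

Dominating : {n : ℕ} → Graph n → Fin n → Set
Dominating G v = ∀ u → ¬ (u ≡ v) → v ∼[ G ] u

InTriangle : {n : ℕ} → Graph n → Fin n → Fin n → Set
InTriangle G u v = ∃ λ w → u ∼[ G ] w × v ∼[ G ] w

-- If every edge lies in a triangle, then any two distinct vertices have exactly one common
-- neighbour: at least one by diameter 2 and the triangles, at most one by C₄-freeness. So G is a
-- friendship graph, and the friendship theorem yields a dominating vertex.
--
-- Friendship theorem: counting walks of length 3 shows that non-adjacent vertices have the same
-- degree, and without a dominating vertex this makes G k-regular. The adjacency matrix then
-- satisfies A² = J + (k - 1) I, whence n = k² - k + 1 and, since every vertex has a non-neighbour,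
-- k ≥ 3. For a prime p dividing k - 1, every diagonal entry of A^p is 1 modulo p, so
-- tr A^p ≡ n ≡ 1. But tr A^p counts the closed walks of length p, on which rotation acts freely
-- because p is prime and there are no loops, so p divides it.

module Submission where

open import Data.Bool using (T)
open import Data.Empty using (⊥; ⊥-elim)
open import Data.Fin using (Fin; zero; suc; punchIn; _≟_; toℕ; inject₁; fromℕ)
open import Data.Fin.Properties
  using (any?; all?; ¬∀⟶∃¬; suc-injective; toℕ-injective; toℕ<n; toℕ-inject₁; toℕ-fromℕ)
open import Data.List using (List; []; _∷_; _++_; _∷ʳ_; length)
open import Data.List.Properties
  using (≡-dec; ∷-injectiveˡ; ∷-injectiveʳ; length-++; ++-identityʳ; ++-assoc; ∷ʳ-injective)
open import Data.List.Relation.Unary.All using () renaming (_∷_ to _∷ᴬ_)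
open import Data.Nat using (ℕ; zero; suc; _+_; _*_; _∸_; _≤_; _<_; z≤n; s≤s; >-nonZero)
  renaming (_≟_ to _≟ℕ_)
open import Data.Nat.Coprimality using (Coprime; coprime-Bézout; prime⇒coprime)
open import Data.Nat.Divisibility
  using (_∣_; divides; _∣0; ∣m∣n⇒∣m+n; ∣m+n∣m⇒∣n; m∣m*n; n∣m*n; ∣1⇒≡1)
open import Data.Nat.GCD using (module Bézout)
open import Data.Nat.Induction using (<-rec)
open import Data.Nat.ListAction using (product)
open import Data.Nat.Primality using (Prime; ¬prime[0]; ¬prime[1])
open import Data.Nat.Primality.Factorisation using (factorise)
open import Data.Nat.Properties
  using (+-*-semiring; +-identityʳ; +-comm; +-cancelʳ-≡; +-mono-≤; +-monoʳ-<;
         *-identityˡ; *-identityʳ; *-zeroʳ; *-comm; *-assoc; *-distribʳ-+;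
         ≤-reflexive; ≤-trans; <⇒≤; <-≤-trans; <-cmp; m≤m+n; m<m+n; n≢0⇒n>0; m<n⇒0<n∸m; m∸n+n≡m)
open import Data.Nat.Tactic.RingSolver using (solve-∀)
open import Data.Product as Product using (∃; _×_; _,_)
open import Data.Sum using (inj₁; inj₂)
import Data.Vec as Vec
open import Data.Vec using ([]; _∷_)
open import Data.Vec.Functional using (removeAt)
open import Data.Vec.Functional.Properties using (removeAt-punchOut)
open import Data.Vec.Relation.Unary.All using ([]; _∷_)
open import Data.Vec.Relation.Unary.Unique.Propositional using (Unique; []; _∷_)
open import Data.Vec.Relation.Unary.Unique.Propositional.Properties using (lookup-injective)
open import Function using (_∘_; id)
import Function.Endo.Propositional as Endo
open import Relation.Binary.Definitions using (DecidableEquality; tri<; tri≈; tri>)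
open import Relation.Binary.PropositionalEquality
  using (_≡_; refl; sym; trans; cong; cong₂; subst; cong-app; module ≡-Reasoning)
open import Relation.Nullary using (¬_; Dec; yes; no; contradiction)
open import Relation.Nullary.Decidable using (T?; ¬?; _→-dec_; _×-dec_; decidable-stable)

open import Algebra.Properties.Semiring.Sum +-*-semiring
  using (sum; sum-syntax; sum-cong-≗; sum-remove; sum-replicate-zero; sum-init-last;
         ∑-comm; ∑-distrib-+; *-distribˡ-sum; *-distribʳ-sum)

open import Defs

[_] : {P : Set} → Dec P → ℕ
[ yes _ ] = 1
[ no _ ] = 0

module _ {P : Set} where

  [yes] : (d : Dec P) → P → [ d ] ≡ 1
  [yes] (yes _) _ = refl
  [yes] (no ¬p) p = contradiction p ¬p

  [no] : (d : Dec P) → ¬ P → [ d ] ≡ 0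
  [no] (yes p) ¬p = contradiction p ¬p
  [no] (no _) _ = refl

  [≢0] : (d : Dec P) → ¬ [ d ] ≡ 0 → P
  [≢0] (yes p) _ = p
  [≢0] (no _) [d]≢0 = contradiction refl [d]≢0

  [≤1] : (d : Dec P) → [ d ] ≤ 1
  [≤1] (yes _) = s≤s z≤n
  [≤1] (no _) = z≤n

  [*]-idem : (d : Dec P) → [ d ] * [ d ] ≡ [ d ]
  [*]-idem (yes _) = refl
  [*]-idem (no _) = refl

  [⇔] : {Q : Set} (d : Dec P) (e : Dec Q) → (P → Q) → (Q → P) → [ d ] ≡ [ e ]
  [⇔] (yes _) (yes _) _ _ = refl
  [⇔] (yes p) (no ¬q) f _ = contradiction (f p) ¬q
  [⇔] (no ¬p) (yes q) _ g = contradiction (g q) ¬p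
  [⇔] (no _) (no _) _ _ = refl

[≟]-sym : ∀ {n} (u v : Fin n) → [ u ≟ v ] ≡ [ v ≟ u ]
[≟]-sym u v = [⇔] (u ≟ v) (v ≟ u) sym sym

sum-const : ∀ n c → ∑[ i < n ] c ≡ n * c
sum-const zero c = refl
sum-const (suc n) c = cong (c +_) (sum-const n c)

sum-single : ∀ {n} (f : Fin n → ℕ) i → (∀ j → ¬ j ≡ i → f j ≡ 0) → sum f ≡ f i
sum-single {suc n} f zero off = begin
  f zero + ∑[ j < n ] f (suc j)  ≡⟨ cong (f zero +_) (sum-cong-≗ (λ j → off (suc j) λ ())) ⟩
  f zero + ∑[ j < n ] 0          ≡⟨ cong (f zero +_) (sum-replicate-zero n) ⟩
  f zero + 0                     ≡⟨ +-identityʳ (f zero) ⟩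
  f zero                         ∎
  where open ≡-Reasoning
sum-single {suc n} f (suc i) off =
  cong₂ _+_ (off zero λ ()) (sum-single (f ∘ suc) i λ j j≢i → off (suc j) (j≢i ∘ suc-injective))

sum-δ : ∀ {n} (u : Fin n) (g : Fin n → ℕ) → ∑[ w < n ] ([ u ≟ w ] * g w) ≡ g u
sum-δ u g = trans (sum-single _ u off) (trans (cong (_* g u) ([yes] (u ≟ u) refl)) (+-identityʳ (g u)))
  where
  off : ∀ w → ¬ w ≡ u → [ u ≟ w ] * g w ≡ 0
  off w w≢u = cong (_* g w) ([no] (u ≟ w) (w≢u ∘ sym))

sum≢0 : ∀ {n} (f : Fin n → ℕ) → ¬ sum f ≡ 0 → ∃ λ i → ¬ f i ≡ 0
sum≢0 {zero} f ∑f≢0 = contradiction refl ∑f≢0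
sum≢0 {suc n} f ∑f≢0 with f zero ≟ℕ 0
... | no f0≢0 = zero , f0≢0
... | yes f0≡0 = Product.map suc id (sum≢0 (f ∘ suc) (∑f≢0 ∘ trans (cong (_+ sum (f ∘ suc)) f0≡0)))

sum≤size : ∀ {n} (f : Fin n → ℕ) → (∀ i → f i ≤ 1) → sum f ≤ n
sum≤size {zero} f f≤1 = z≤n
sum≤size {suc n} f f≤1 = +-mono-≤ (f≤1 zero) (sum≤size (f ∘ suc) (f≤1 ∘ suc))

sum-removeAt-zero : ∀ {n} (f : Fin (suc n) → ℕ) {i} → f i ≡ 0 → sum f ≡ sum (removeAt f i)
sum-removeAt-zero f {i} fi≡0 = trans (sum-remove {i = i} f) (cong (_+ sum (removeAt f i)) fi≡0)

sum<size : ∀ {n} (f : Fin n → ℕ) → (∀ i → f i ≤ 1) → ∀ {i} → f i ≡ 0 → suc (sum f) ≤ n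
sum<size {suc n} f f≤1 {i} fi≡0 =
  s≤s (subst (_≤ n) (sym (sum-removeAt-zero f fi≡0)) (sum≤size (removeAt f i) (f≤1 ∘ punchIn i)))

sum+2≤size : ∀ {n} (f : Fin n → ℕ) → (∀ i → f i ≤ 1) →
             ∀ {i j} → ¬ i ≡ j → f i ≡ 0 → f j ≡ 0 → 2 + sum f ≤ n
sum+2≤size {suc n} f f≤1 {i} {j} i≢j fi≡0 fj≡0 =
  s≤s (subst (λ s → suc s ≤ n) (sym (sum-removeAt-zero f fi≡0))
        (sum<size (removeAt f i) (f≤1 ∘ punchIn i) (trans (removeAt-punchOut f i≢j) fj≡0)))

module _ {A : Set} (f : A → A) where
  open Endo A using (_^_; ^-homo)
  open ≡-Reasoning

  ^-+ : ∀ m k x → (f ^ (m + k)) x ≡ (f ^ m) ((f ^ k) x)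
  ^-+ m k = cong-app (^-homo f m k)

  ^-suc′ : ∀ m x → (f ^ suc m) x ≡ (f ^ m) (f x)
  ^-suc′ m x = trans (cong (λ i → (f ^ i) x) (+-comm 1 m)) (^-+ m 1 x)

  ^-fixed-* : ∀ {e x} → (f ^ e) x ≡ x → ∀ c → (f ^ (c * e)) x ≡ x
  ^-fixed-* fe zero = refl
  ^-fixed-* {e} {x} fe (suc c) = trans (^-+ e (c * e) x) (trans (cong (f ^ e) (^-fixed-* fe c)) fe)

  ^-fixed-Bézout : ∀ {r s x} → (f ^ r) x ≡ x → (f ^ s) x ≡ x → ∀ a b → 1 + b * r ≡ a * s → f x ≡ x
  ^-fixed-Bézout {r} {s} {x} fr fs a b eq = begin
    f x                  ≡⟨ cong f (^-fixed-* fr b) ⟨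
    (f ^ (1 + b * r)) x  ≡⟨ cong (λ i → (f ^ i) x) eq ⟩
    (f ^ (a * s)) x      ≡⟨ ^-fixed-* fs a ⟩
    x                    ∎

  ^-fixed-coprime : ∀ {m e x} → (f ^ m) x ≡ x → (f ^ e) x ≡ x → Coprime m e → f x ≡ x
  ^-fixed-coprime fm fe m⊥e with coprime-Bézout m⊥e
  ... | Bézout.+- a b eq = ^-fixed-Bézout fe fm a b eq
  ... | Bézout.-+ a b eq = ^-fixed-Bézout fm fe b a eq

  -- The difference of the exponents of two colliding iterates is a second period, coprime to p.
  ^-collision-prime : ∀ {p x} → Prime p → (f ^ p) x ≡ x →
                      ∀ {i j} → i < j → j < p → (f ^ i) x ≡ (f ^ j) x → f x ≡ x
  ^-collision-prime {p} {x} p-prime fp {i} {j} i<j j<p fi≡fj =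
    ^-fixed-coprime fp fe (prime⇒coprime p-prime {{>-nonZero 0<e}} e<p)
    where
    e : ℕ
    e = p ∸ j + i
    p∸j+j≡p : p ∸ j + j ≡ p
    p∸j+j≡p = m∸n+n≡m (<⇒≤ j<p)
    fe : (f ^ e) x ≡ x
    fe = begin
      (f ^ (p ∸ j + i)) x          ≡⟨ ^-+ (p ∸ j) i x ⟩
      (f ^ (p ∸ j)) ((f ^ i) x)    ≡⟨ cong (f ^ (p ∸ j)) fi≡fj ⟩
      (f ^ (p ∸ j)) ((f ^ j) x)    ≡⟨ ^-+ (p ∸ j) j x ⟨
      (f ^ (p ∸ j + j)) x          ≡⟨ cong (λ k → (f ^ k) x) p∸j+j≡p ⟩
      (f ^ p) x                    ≡⟨ fp ⟩
      x                            ∎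
    e<p : e < p
    e<p = subst (e <_) p∸j+j≡p (+-monoʳ-< (p ∸ j) i<j)
    0<e : 0 < e
    0<e = <-≤-trans (m<n⇒0<n∸m j<p) (m≤m+n (p ∸ j) i)

  ^-injective-prime : ∀ {p x} → Prime p → (f ^ p) x ≡ x → ¬ f x ≡ x →
                      ∀ {i j} → i < p → j < p → (f ^ i) x ≡ (f ^ j) x → i ≡ j
  ^-injective-prime p-prime fp ¬fx≡x {i} {j} i<p j<p fi≡fj with <-cmp i j
  ... | tri< i<j _ _ = contradiction (^-collision-prime p-prime fp i<j j<p fi≡fj) ¬fx≡x
  ... | tri≈ _ i≡j _ = i≡j
  ... | tri> _ _ j<i = contradiction (^-collision-prime p-prime fp j<i i<p (sym fi≡fj)) ¬fx≡x

module _ {A : Set} where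
  open Endo (List A) using (_^_)
  open ≡-Reasoning

  rotate : List A → List A
  rotate [] = []
  rotate (x ∷ xs) = xs ∷ʳ x

  length-rotate : ∀ y → length (rotate y) ≡ length y
  length-rotate [] = refl
  length-rotate (x ∷ xs) = trans (length-++ xs) (+-comm (length xs) 1)

  rotate-injective : ∀ {y z} → rotate y ≡ rotate z → y ≡ z
  rotate-injective {[]} {[]} _ = refl
  rotate-injective {[]} {_ ∷ []} ()
  rotate-injective {[]} {_ ∷ _ ∷ _} ()
  rotate-injective {_ ∷ []} {[]} ()
  rotate-injective {_ ∷ _ ∷ _} {[]} ()
  rotate-injective {x ∷ xs} {z ∷ zs} eq with ∷ʳ-injective xs zs eq
  ... | refl , refl = refl

  rotate^-++ : ∀ xs ys → (rotate ^ length xs) (xs ++ ys) ≡ ys ++ xs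
  rotate^-++ [] ys = sym (++-identityʳ ys)
  rotate^-++ (x ∷ xs) ys = begin
    (rotate ^ suc (length xs)) (x ∷ xs ++ ys)
      ≡⟨ ^-suc′ rotate (length xs) (x ∷ xs ++ ys) ⟩
    (rotate ^ length xs) ((xs ++ ys) ∷ʳ x)
      ≡⟨ cong (rotate ^ length xs) (++-assoc xs ys (x ∷ [])) ⟩
    (rotate ^ length xs) (xs ++ (ys ∷ʳ x))
      ≡⟨ rotate^-++ xs (ys ∷ʳ x) ⟩
    (ys ∷ʳ x) ++ xs
      ≡⟨ ++-assoc ys (x ∷ []) xs ⟩
    ys ++ x ∷ xs
      ∎

  length-rotate^ : ∀ k y → length ((rotate ^ k) y) ≡ length y
  length-rotate^ zero y = refl
  length-rotate^ (suc k) y = trans (length-rotate ((rotate ^ k) y)) (length-rotate^ k y)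

  rotate^length : ∀ y → (rotate ^ length y) y ≡ y
  rotate^length y = trans (cong (rotate ^ length y) (sym (++-identityʳ y))) (rotate^-++ y [])

module _ {n : ℕ} where

  _≟ʷ_ : DecidableEquality (List (Fin n))
  _≟ʷ_ = ≡-dec _≟_

  ∑ʷ : ℕ → (List (Fin n) → ℕ) → ℕ
  ∑ʷ zero g = g []
  ∑ʷ (suc m) g = ∑[ x < n ] ∑ʷ m (g ∘ (x ∷_))

  ∑ʷ-cong : ∀ m {g h : List (Fin n) → ℕ} → (∀ y → g y ≡ h y) → ∑ʷ m g ≡ ∑ʷ m h
  ∑ʷ-cong zero g≗h = g≗h []
  ∑ʷ-cong (suc m) g≗h = sum-cong-≗ λ x → ∑ʷ-cong m (g≗h ∘ (x ∷_))

  ∑ʷ-zero : ∀ m → ∑ʷ m (λ _ → 0) ≡ 0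
  ∑ʷ-zero zero = refl
  ∑ʷ-zero (suc m) = trans (sum-cong-≗ {n} λ _ → ∑ʷ-zero m) (sum-replicate-zero n)

  ∑ʷ-distrib-+ : ∀ m (g h : List (Fin n) → ℕ) → ∑ʷ m (λ y → g y + h y) ≡ ∑ʷ m g + ∑ʷ m h
  ∑ʷ-distrib-+ zero g h = refl
  ∑ʷ-distrib-+ (suc m) g h =
    trans (sum-cong-≗ λ x → ∑ʷ-distrib-+ m (g ∘ (x ∷_)) (h ∘ (x ∷_)))
          (∑-distrib-+ (λ x → ∑ʷ m (g ∘ (x ∷_))) (λ x → ∑ʷ m (h ∘ (x ∷_))))

  *-distribˡ-∑ʷ : ∀ m c (g : List (Fin n) → ℕ) → c * ∑ʷ m g ≡ ∑ʷ m (λ y → c * g y)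
  *-distribˡ-∑ʷ zero c g = refl
  *-distribˡ-∑ʷ (suc m) c g =
    trans (*-distribˡ-sum c (λ x → ∑ʷ m (g ∘ (x ∷_)))) (sum-cong-≗ λ x → *-distribˡ-∑ʷ m c (g ∘ (x ∷_)))

  ∑ʷ-comm : ∀ m {k} (g : Fin k → List (Fin n) → ℕ) →
            ∑ʷ m (λ y → ∑[ i < k ] g i y) ≡ ∑[ i < k ] ∑ʷ m (g i)
  ∑ʷ-comm zero g = refl
  ∑ʷ-comm (suc m) g =
    trans (sum-cong-≗ λ x → ∑ʷ-comm m λ i → g i ∘ (x ∷_)) (∑-comm λ x i → ∑ʷ m (g i ∘ (x ∷_)))

  ∑ʷ-single : ∀ m (g : List (Fin n) → ℕ) z → length z ≡ m → (∀ y → ¬ y ≡ z → g y ≡ 0) → ∑ʷ m g ≡ g z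
  ∑ʷ-single zero g [] refl _ = refl
  ∑ʷ-single (suc m) g (x ∷ z) refl off = begin
    ∑[ x′ < n ] ∑ʷ m (g ∘ (x′ ∷_))
      ≡⟨ sum-single _ x (λ x′ x′≢x → trans (∑ʷ-cong m (λ y → off _ (x′≢x ∘ ∷-injectiveˡ))) (∑ʷ-zero m)) ⟩
    ∑ʷ m (g ∘ (x ∷_))
      ≡⟨ ∑ʷ-single m (g ∘ (x ∷_)) z refl (λ y y≢z → off _ (y≢z ∘ ∷-injectiveʳ)) ⟩
    g (x ∷ z)
      ∎
    where open ≡-Reasoning

  ∑ʷ≢0 : ∀ m (g : List (Fin n) → ℕ) → ¬ ∑ʷ m g ≡ 0 → ∃ λ y → length y ≡ m × ¬ g y ≡ 0
  ∑ʷ≢0 zero g g[]≢0 = [] , refl , g[]≢0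
  ∑ʷ≢0 (suc m) g ∑g≢0 with sum≢0 _ ∑g≢0
  ... | x , ∑gx≢0 with ∑ʷ≢0 m (g ∘ (x ∷_)) ∑gx≢0
  ...   | y , refl , gxy≢0 = x ∷ y , refl , gxy≢0

  ∑ʷ-δ : ∀ m z (g : List (Fin n) → ℕ) → length z ≡ m → ∑ʷ m (λ y → [ y ≟ʷ z ] * g y) ≡ g z
  ∑ʷ-δ m z g |z|≡m = begin
    ∑ʷ m (λ y → [ y ≟ʷ z ] * g y)
      ≡⟨ ∑ʷ-single m _ z |z|≡m (λ y y≢z → cong (_* g y) ([no] (y ≟ʷ z) y≢z)) ⟩
    [ z ≟ʷ z ] * g z
      ≡⟨ cong (_* g z) ([yes] (z ≟ʷ z) refl) ⟩
    1 * g z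
      ≡⟨ *-identityˡ (g z) ⟩
    g z
      ∎
    where open ≡-Reasoning

module _ {n : ℕ} where
  open Endo (List (Fin n)) using (_^_)
  open ≡-Reasoning

  -- h′ is h with the orbit of x cut out of its support. The orbit has exactly p elements,
  -- because rotation has period p on it, p is prime and x is not fixed.
  module Orbit {p′} (p-prime : Prime (suc p′)) (h : List (Fin n) → ℕ)
               (h-rotate : ∀ y → h (rotate y) ≡ h y) (h-fixed : ∀ y → rotate y ≡ y → h y ≡ 0)
               (x : List (Fin n)) (|x|≡p : length x ≡ suc p′) (hx≢0 : ¬ h x ≡ 0) where

    p : ℕ
    p = suc p′

    rotate^p : ∀ {y} → length y ≡ p → (rotate ^ p) y ≡ y
    rotate^p {y} |y|≡p = subst (λ k → (rotate ^ k) y ≡ y) |y|≡p (rotate^length y)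

    orbit : Fin p → List (Fin n)
    orbit i = (rotate ^ toℕ i) x

    orbit-injective : ∀ {i j} → orbit i ≡ orbit j → i ≡ j
    orbit-injective {i} {j} =
      toℕ-injective ∘ ^-injective-prime rotate p-prime (rotate^p |x|≡p) (hx≢0 ∘ h-fixed x) (toℕ<n i) (toℕ<n j)

    h-rotate^ : ∀ k → h ((rotate ^ k) x) ≡ h x
    h-rotate^ zero = refl
    h-rotate^ (suc k) = trans (h-rotate _) (h-rotate^ k)

    count : List (Fin n) → ℕ
    count y = ∑[ i < p ] [ y ≟ʷ orbit i ]

    count≤1 : ∀ y → count y ≤ 1
    count≤1 y with count y ≟ℕ 0
    ... | yes count≡0 = subst (_≤ 1) (sym count≡0) z≤n
    ... | no count≢0 with sum≢0 _ count≢0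
    ...   | i , term≢0 = ≤-reflexive (trans (sum-single _ i off) ([yes] (y ≟ʷ orbit i) y≡oi))
      where
      y≡oi : y ≡ orbit i
      y≡oi = [≢0] (y ≟ʷ orbit i) term≢0
      off : ∀ j → ¬ j ≡ i → [ y ≟ʷ orbit j ] ≡ 0
      off j j≢i = [no] (y ≟ʷ orbit j) (λ y≡oj → j≢i (orbit-injective (trans (sym y≡oj) y≡oi)))

    count-rotate : ∀ y → count (rotate y) ≡ count y
    count-rotate y = begin
      [ rotate y ≟ʷ x ] + ∑[ i < p′ ] [ rotate y ≟ʷ rotate ((rotate ^ toℕ i) x) ]
        ≡⟨ cong₂ _+_ last-term (sum-cong-≗ init-term) ⟩
      [ y ≟ʷ orbit (fromℕ p′) ] + ∑[ i < p′ ] [ y ≟ʷ orbit (inject₁ i) ]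
        ≡⟨ +-comm [ y ≟ʷ orbit (fromℕ p′) ] _ ⟩
      ∑[ i < p′ ] [ y ≟ʷ orbit (inject₁ i) ] + [ y ≟ʷ orbit (fromℕ p′) ]
        ≡⟨ sum-init-last (λ i → [ y ≟ʷ orbit i ]) ⟨
      count y ∎
      where
      orbit-last : orbit (fromℕ p′) ≡ (rotate ^ p′) x
      orbit-last = cong (λ k → (rotate ^ k) x) (toℕ-fromℕ p′)
      last-term : [ rotate y ≟ʷ x ] ≡ [ y ≟ʷ orbit (fromℕ p′) ]
      last-term = [⇔] _ _
        (λ ry≡x → begin
          y
            ≡⟨ rotate^p (trans (sym (length-rotate y)) (trans (cong length ry≡x) |x|≡p)) ⟨
          (rotate ^ p) y
            ≡⟨ ^-suc′ rotate p′ y ⟩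
          (rotate ^ p′) (rotate y)
            ≡⟨ cong (rotate ^ p′) ry≡x ⟩
          (rotate ^ p′) x
            ≡⟨ orbit-last ⟨
          orbit (fromℕ p′)
            ∎)
        (λ y≡ol → trans (cong rotate (trans y≡ol orbit-last)) (rotate^p |x|≡p))
      orbit-inject₁ : ∀ i → orbit (inject₁ i) ≡ (rotate ^ toℕ i) x
      orbit-inject₁ i = cong (λ k → (rotate ^ k) x) (toℕ-inject₁ i)
      init-term : ∀ i → [ rotate y ≟ʷ rotate ((rotate ^ toℕ i) x) ] ≡ [ y ≟ʷ orbit (inject₁ i) ]
      init-term i = [⇔] _ _ (λ e → trans (rotate-injective e) (sym (orbit-inject₁ i)))
                            (λ e → cong rotate (trans e (orbit-inject₁ i)))

    ∑ʷ-count : ∑ʷ p (λ y → count y * h y) ≡ p * h x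
    ∑ʷ-count = begin
      ∑ʷ p (λ y → count y * h y)
        ≡⟨ ∑ʷ-cong p (λ y → *-distribʳ-sum (h y) (λ i → [ y ≟ʷ orbit i ])) ⟩
      ∑ʷ p (λ y → ∑[ i < p ] ([ y ≟ʷ orbit i ] * h y))
        ≡⟨ ∑ʷ-comm p (λ i y → [ y ≟ʷ orbit i ] * h y) ⟩
      ∑[ i < p ] ∑ʷ p (λ y → [ y ≟ʷ orbit i ] * h y)
        ≡⟨ sum-cong-≗ (λ i → ∑ʷ-δ p (orbit i) h (trans (length-rotate^ (toℕ i) x) |x|≡p)) ⟩
      ∑[ i < p ] h (orbit i)
        ≡⟨ sum-cong-≗ {p} (h-rotate^ ∘ toℕ) ⟩
      ∑[ i < p ] h x
        ≡⟨ sum-const p (h x) ⟩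
      p * h x
        ∎

    h′ : List (Fin n) → ℕ
    h′ y = (1 ∸ count y) * h y

    h′-rotate : ∀ y → h′ (rotate y) ≡ h′ y
    h′-rotate y = cong₂ (λ c v → (1 ∸ c) * v) (count-rotate y) (h-rotate y)

    h′-fixed : ∀ y → rotate y ≡ y → h′ y ≡ 0
    h′-fixed y ry≡y = trans (cong ((1 ∸ count y) *_) (h-fixed y ry≡y)) (*-zeroʳ (1 ∸ count y))

    h-split : ∀ y → h y ≡ h′ y + count y * h y
    h-split y = begin
      h y                              ≡⟨ *-identityˡ (h y) ⟨
      1 * h y                          ≡⟨ cong (_* h y) (m∸n+n≡m (count≤1 y)) ⟨
      (1 ∸ count y + count y) * h y    ≡⟨ *-distribʳ-+ (h y) (1 ∸ count y) (count y) ⟩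
      h′ y + count y * h y             ∎

    ∑ʷ-remove-orbit : ∑ʷ p h ≡ ∑ʷ p h′ + p * h x
    ∑ʷ-remove-orbit = begin
      ∑ʷ p h                                  ≡⟨ ∑ʷ-cong p h-split ⟩
      ∑ʷ p (λ y → h′ y + count y * h y)       ≡⟨ ∑ʷ-distrib-+ p h′ (λ y → count y * h y) ⟩
      ∑ʷ p h′ + ∑ʷ p (λ y → count y * h y)    ≡⟨ cong (∑ʷ p h′ +_) ∑ʷ-count ⟩
      ∑ʷ p h′ + p * h x                       ∎

  necklace : ∀ {p} → Prime p → (h : List (Fin n) → ℕ) →
             (∀ y → h (rotate y) ≡ h y) → (∀ y → rotate y ≡ y → h y ≡ 0) → p ∣ ∑ʷ p h
  necklace {zero} p-prime = contradiction p-prime ¬prime[0]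
  necklace {suc p′} p-prime h h-rotate h-fixed = <-rec P step (∑ʷ p h) h h-rotate h-fixed refl
    where
    p : ℕ
    p = suc p′
    P : ℕ → Set
    P N = ∀ h → (∀ y → h (rotate y) ≡ h y) → (∀ y → rotate y ≡ y → h y ≡ 0) → ∑ʷ p h ≡ N → p ∣ N
    step : ∀ N → (∀ {M} → M < N → P M) → P N
    step N ih h h-rotate h-fixed ∑h≡N with N ≟ℕ 0
    ... | yes N≡0 = subst (p ∣_) (sym N≡0) (p ∣0)
    ... | no N≢0 with ∑ʷ≢0 p h (N≢0 ∘ trans (sym ∑h≡N))
    ...   | x , |x|≡p , hx≢0 =
      subst (p ∣_) N≡ (∣m∣n⇒∣m+n (ih smaller h′ h′-rotate h′-fixed refl) (m∣m*n (h x)))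
      where
      open Orbit p-prime h h-rotate h-fixed x |x|≡p hx≢0 using (h′; h′-rotate; h′-fixed; ∑ʷ-remove-orbit)
      N≡ : ∑ʷ p h′ + p * h x ≡ N
      N≡ = trans (sym ∑ʷ-remove-orbit) ∑h≡N
      smaller : ∑ʷ p h′ < N
      smaller = subst (∑ʷ p h′ <_) N≡ (m<m+n _ (≤-trans (n≢0⇒n>0 hx≢0) (m≤m+n (h x) (p′ * h x))))

infix 4 _≡1[mod_]

_≡1[mod_] : ℕ → ℕ → Set
a ≡1[mod p ] = ∃ λ c → a ≡ 1 + c * p

module _ {p : ℕ} where
  open import Data.Nat using (_^_)

  *-≡1[mod] : ∀ {a b} → a ≡1[mod p ] → b ≡1[mod p ] → a * b ≡1[mod p ]
  *-≡1[mod] (c , refl) (d , refl) = d + c * (1 + d * p) , identity c d p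
    where
    identity : ∀ c d p → (1 + c * p) * (1 + d * p) ≡ 1 + (d + c * (1 + d * p)) * p
    identity = solve-∀

  ^-≡1[mod] : ∀ {a} → a ≡1[mod p ] → ∀ m → a ^ m ≡1[mod p ]
  ^-≡1[mod] a≡1 zero = 0 , refl
  ^-≡1[mod] a≡1 (suc m) = *-≡1[mod] a≡1 (^-≡1[mod] a≡1 m)

  sum-≡1[mod] : ∀ {n} → n ≡1[mod p ] → (f : Fin n → ℕ) → (∀ i → f i ≡1[mod p ]) → sum f ≡1[mod p ]
  sum-≡1[mod] {n} (d , refl) f f≡1 with sum≡size[mod] f f≡1
    where
    sum≡size[mod] : ∀ {m} (f : Fin m → ℕ) → (∀ i → f i ≡1[mod p ]) → ∃ λ c → sum f ≡ m + c * p
    sum≡size[mod] {zero} f _ = 0 , refl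
    sum≡size[mod] {suc m} f f≡1 with f≡1 zero | sum≡size[mod] (f ∘ suc) (f≡1 ∘ suc)
    ... | c , f0≡ | e , ∑≡ = c + e , trans (cong₂ _+_ f0≡ ∑≡) (identity c e m p)
      where
      identity : ∀ c e m p → 1 + c * p + (m + e * p) ≡ suc m + (c + e) * p
      identity = solve-∀
  ... | c , ∑≡ = d + c , trans ∑≡ (identity d c p)
    where
    identity : ∀ d c p → 1 + d * p + c * p ≡ 1 + (d + c) * p
    identity = solve-∀

  ≡1[mod]-cancel : ∀ {a b k w} → a + w ≡ b + k * w → b ≡1[mod p ] → k ≡1[mod p ] → a ≡1[mod p ]
  ≡1[mod]-cancel {a} {w = w} eq (c , refl) (e , refl) =
    c + e * w , +-cancelʳ-≡ w a _ (trans eq (identity c e p w))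
    where
    identity : ∀ c e p w → 1 + c * p + (1 + e * p) * w ≡ 1 + (c + e * w) * p + w
    identity = solve-∀

  ≡1[mod]⇒∤ : Prime p → ∀ {a} → a ≡1[mod p ] → ¬ p ∣ a
  ≡1[mod]⇒∤ p-prime (c , refl) p∣1+cp = ¬prime[1] (subst Prime (∣1⇒≡1 p∣1) p-prime)
    where
    p∣1 : p ∣ 1
    p∣1 = ∣m+n∣m⇒∣n (subst (p ∣_) (+-comm 1 (c * p)) p∣1+cp) (n∣m*n c)

∃-prime-∣ : ∀ {m} → 2 ≤ m → ∃ λ p → Prime p × p ∣ m
∃-prime-∣ {m@(suc _)} 2≤m with factorise m
... | record { factors = [] ; isFactorisation = m≡1 } = contradiction (subst (2 ≤_) m≡1 2≤m) λ { (s≤s ()) }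
... | record { factors = q ∷ qs ; isFactorisation = m≡q*qs ; factorsPrime = q-prime ∷ᴬ _ } =
  q , q-prime , divides (product qs) (trans m≡q*qs (*-comm q (product qs)))

degree-decomposition : ∀ {n k} → k * k + 1 ≡ n + k → 2 + k ≤ n →
                       ∃ λ k′ → k ≡ suc k′ × 2 ≤ k′ × n ≡ 1 + k′ * k
degree-decomposition {n} {zero} eq 2≤n =
  contradiction (subst (2 ≤_) (+-cancelʳ-≡ 0 n 1 (sym eq)) 2≤n) λ { (s≤s ()) }
degree-decomposition {n} {suc k′} eq 3+k′≤n = k′ , refl , 2≤k′ k′ n≡ 3+k′≤n , n≡
  where
  identity : ∀ k′ → suc k′ * suc k′ + 1 ≡ 1 + k′ * suc k′ + suc k′
  identity = solve-∀
  n≡ : n ≡ 1 + k′ * suc k′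
  n≡ = +-cancelʳ-≡ (suc k′) n (1 + k′ * suc k′) (trans (sym eq) (identity k′))
  2≤k′ : ∀ k′ {n} → n ≡ 1 + k′ * suc k′ → 3 + k′ ≤ n → 2 ≤ k′
  2≤k′ zero refl (s≤s ())
  2≤k′ (suc zero) refl (s≤s (s≤s (s≤s ())))
  2≤k′ (suc (suc _)) _ _ = s≤s (s≤s z≤n)

module Adjacency {n : ℕ} (G : Graph n) where

  infix 4 _~_ _~?_

  _~_ : Fin n → Fin n → Set
  u ~ v = u ∼[ G ] v

  _~?_ : ∀ u v → Dec (u ~ v)
  u ~? v = T? (adj G u v)

  ~-sym : ∀ {u v} → u ~ v → v ~ u
  ~-sym {u} {v} = subst T (adj-sym G u v)

  ~-irrefl : ∀ {u} → ¬ u ~ u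
  ~-irrefl {u} = subst T (adj-irrefl G u)

  ~⇒≢ : ∀ {u v} → u ~ v → ¬ u ≡ v
  ~⇒≢ u~u refl = ~-irrefl u~u

  A : Fin n → Fin n → ℕ
  A u v = [ u ~? v ]

  A-sym : ∀ u v → A u v ≡ A v u
  A-sym u v = [⇔] (u ~? v) (v ~? u) ~-sym ~-sym

  A-irrefl : ∀ u → A u u ≡ 0
  A-irrefl u = [no] (u ~? u) ~-irrefl

  degree : Fin n → ℕ
  degree u = ∑[ v < n ] A u v

  dominating? : ∀ v → Dec (Dominating G v)
  dominating? v = all? λ u → ¬? (u ≟ v) →-dec v ~? u

  non-neighbour : ∀ {v} → ¬ Dominating G v → ∃ λ u → ¬ u ≡ v × ¬ v ~ u
  non-neighbour {v} ¬dominating with ¬∀⟶∃¬ n _ (λ u → ¬? (u ≟ v) →-dec v ~? u) ¬dominating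
  ... | u , ¬[u≢v→v~u] =
    u , (λ u≡v → ¬[u≢v→v~u] λ u≢v → contradiction u≡v u≢v) , (λ v~u → ¬[u≢v→v~u] λ _ → v~u)

  triangle? : ∀ u v → Dec (InTriangle G u v)
  triangle? u v = any? λ w → (u ~? w) ×-dec (v ~? w)

  bare-edge? : Dec (∃ λ u → ∃ λ v → u ~ v × ¬ InTriangle G u v)
  bare-edge? = any? λ u → any? λ v → (u ~? v) ×-dec ¬? (triangle? u v)

  ¬bare-edge⇒in-triangle : ¬ (∃ λ u → ∃ λ v → u ~ v × ¬ InTriangle G u v) → ∀ u v → u ~ v → InTriangle G u v
  ¬bare-edge⇒in-triangle ¬bare-edge u v u~v =
    decidable-stable (triangle? u v) λ ¬in-triangle → ¬bare-edge (u , v , u~v , ¬in-triangle)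

  C4Free⇒no-4-cycle : C4Free G → ∀ {a b c d} → a ~ b → b ~ c → c ~ d → d ~ a → ¬ a ≡ c → ¬ b ≡ d → ⊥
  C4Free⇒no-4-cycle c4-free {a} {b} {c} {d} a~b b~c c~d d~a a≢c b≢d =
    c4-free (cycle , (λ {i} {j} → lookup-injective distinct i j) , edges)
    where
    cycle : Fin 4 → Fin n
    cycle = Vec.lookup (a ∷ b ∷ c ∷ d ∷ [])
    distinct : Unique (a ∷ b ∷ c ∷ d ∷ [])
    distinct = (~⇒≢ a~b ∷ a≢c ∷ ~⇒≢ (~-sym d~a) ∷ [])
             ∷ (~⇒≢ b~c ∷ b≢d ∷ [])
             ∷ (~⇒≢ c~d ∷ [])
             ∷ []
             ∷ []
    edges : IsHom C₄ G cycle
    edges zero zero ()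
    edges zero (suc zero) _ = a~b
    edges zero (suc (suc zero)) ()
    edges zero (suc (suc (suc zero))) _ = ~-sym d~a
    edges (suc zero) zero _ = ~-sym a~b
    edges (suc zero) (suc zero) ()
    edges (suc zero) (suc (suc zero)) _ = b~c
    edges (suc zero) (suc (suc (suc zero))) ()
    edges (suc (suc zero)) zero ()
    edges (suc (suc zero)) (suc zero) _ = ~-sym b~c
    edges (suc (suc zero)) (suc (suc zero)) ()
    edges (suc (suc zero)) (suc (suc (suc zero))) _ = c~d
    edges (suc (suc (suc zero))) zero _ = d~a
    edges (suc (suc (suc zero))) (suc zero) ()
    edges (suc (suc (suc zero))) (suc (suc zero)) _ = ~-sym c~d
    edges (suc (suc (suc zero))) (suc (suc (suc zero))) ()

module Walks {n : ℕ} (G : Graph n) where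
  open Adjacency G
  open import Data.Nat using (_^_)
  open ≡-Reasoning

  -- walks m u v is the (u, v) entry of the m-th power of the adjacency matrix.
  walks : ℕ → Fin n → Fin n → ℕ
  walks zero u v = [ u ≟ v ]
  walks (suc m) u v = ∑[ x < n ] (A u x * walks m x v)

  walks-1 : ∀ u v → walks 1 u v ≡ A u v
  walks-1 u v = begin
    ∑[ x < n ] (A u x * [ x ≟ v ])
      ≡⟨ sum-cong-≗ (λ x → trans (*-comm (A u x) [ x ≟ v ]) (cong (_* A u x) ([≟]-sym x v))) ⟩
    ∑[ x < n ] ([ v ≟ x ] * A u x)
      ≡⟨ sum-δ v (A u) ⟩
    A u v
      ∎

  walks-+ : ∀ k m u v → walks (k + m) u v ≡ ∑[ w < n ] (walks k u w * walks m w v)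
  walks-+ zero m u v = sym (sum-δ u (λ w → walks m w v))
  walks-+ (suc k) m u v = begin
    ∑[ x < n ] (A u x * walks (k + m) x v)
      ≡⟨ sum-cong-≗ (λ x → cong (A u x *_) (walks-+ k m x v)) ⟩
    ∑[ x < n ] (A u x * ∑[ w < n ] (walks k x w * walks m w v))
      ≡⟨ sum-cong-≗ (λ x → *-distribˡ-sum (A u x) (λ w → walks k x w * walks m w v)) ⟩
    ∑[ x < n ] ∑[ w < n ] (A u x * (walks k x w * walks m w v))
      ≡⟨ ∑-comm (λ x w → A u x * (walks k x w * walks m w v)) ⟩
    ∑[ w < n ] ∑[ x < n ] (A u x * (walks k x w * walks m w v))
      ≡⟨ sum-cong-≗ (λ w → sum-cong-≗ (λ x → *-assoc (A u x) (walks k x w) (walks m w v))) ⟨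
    ∑[ w < n ] ∑[ x < n ] (A u x * walks k x w * walks m w v)
      ≡⟨ sum-cong-≗ (λ w → *-distribʳ-sum (walks m w v) (λ x → A u x * walks k x w)) ⟨
    ∑[ w < n ] (walks (suc k) u w * walks m w v)
      ∎

  walks-sym : ∀ m u v → walks m u v ≡ walks m v u
  walks-sym zero u v = [≟]-sym u v
  walks-sym (suc m) u v = begin
    ∑[ x < n ] (A u x * walks m x v)
      ≡⟨ sum-cong-≗ (λ x → trans (*-comm (A u x) (walks m x v)) (cong₂ _*_ (walks-sym m x v) (A≡walks-1 x))) ⟩
    ∑[ x < n ] (walks m v x * walks 1 x u)
      ≡⟨ walks-+ m 1 v u ⟨
    walks (m + 1) v u
      ≡⟨ cong (λ k → walks k v u) (+-comm m 1) ⟩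
    walks (suc m) v u
      ∎
    where
    A≡walks-1 : ∀ x → A u x ≡ walks 1 x u
    A≡walks-1 x = trans (A-sym u x) (sym (walks-1 x u))

  walk : Fin n → List (Fin n) → Fin n → ℕ
  walk u [] v = A u v
  walk u (x ∷ xs) v = A u x * walk x xs v

  walks-∑ʷ : ∀ m u v → walks (suc m) u v ≡ ∑ʷ m (λ xs → walk u xs v)
  walks-∑ʷ zero u v = walks-1 u v
  walks-∑ʷ (suc m) u v = sum-cong-≗ λ x → begin
    A u x * walks (suc m) x v             ≡⟨ cong (A u x *_) (walks-∑ʷ m x v) ⟩
    A u x * ∑ʷ m (λ xs → walk x xs v)     ≡⟨ *-distribˡ-∑ʷ m (A u x) (λ xs → walk x xs v) ⟩
    ∑ʷ m (λ xs → A u x * walk x xs v)     ∎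

  -- The word u ∷ xs stands for the closed walk u xs u.
  closedWalk : List (Fin n) → ℕ
  closedWalk [] = 0
  closedWalk (u ∷ xs) = walk u xs u

  walk-∷ʳ : ∀ x ys u z → walk x (ys ∷ʳ u) z ≡ walk x ys u * A u z
  walk-∷ʳ x [] u z = refl
  walk-∷ʳ x (y ∷ ys) u z = trans (cong (A x y *_) (walk-∷ʳ y ys u z)) (sym (*-assoc (A x y) _ _))

  closedWalk-rotate : ∀ y → closedWalk (rotate y) ≡ closedWalk y
  closedWalk-rotate [] = refl
  closedWalk-rotate (u ∷ []) = refl
  closedWalk-rotate (u ∷ x ∷ ys) = trans (walk-∷ʳ x ys u x) (*-comm _ (A u x))

  closedWalk-fixed : ∀ y → rotate y ≡ y → closedWalk y ≡ 0
  closedWalk-fixed [] _ = refl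
  closedWalk-fixed (u ∷ []) _ = A-irrefl u
  closedWalk-fixed (u ∷ x ∷ ys) ry≡y with ∷-injectiveˡ ry≡y
  ... | refl = cong (_* walk u ys u) (A-irrefl u)

  -- Rotation acts freely on closed walks of prime length p, since a graph has no loops.
  prime-∣-trace : ∀ {p} → Prime p → p ∣ ∑[ u < n ] walks p u u
  prime-∣-trace {zero} p-prime = contradiction p-prime ¬prime[0]
  prime-∣-trace {suc m} p-prime =
    subst (suc m ∣_) (sym (sum-cong-≗ λ u → walks-∑ʷ m u u))
          (necklace p-prime closedWalk closedWalk-rotate closedWalk-fixed)

  column-sum : ∀ {k} → (∀ u → degree u ≡ k) → ∀ m v → ∑[ u < n ] walks m u v ≡ k ^ m
  column-sum regular zero v = begin
    ∑[ u < n ] [ u ≟ v ]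
      ≡⟨ sum-cong-≗ (λ u → trans ([≟]-sym u v) (sym (*-identityʳ _))) ⟩
    ∑[ u < n ] ([ v ≟ u ] * 1)
      ≡⟨ sum-δ v (λ _ → 1) ⟩
    1
      ∎
  column-sum {k} regular (suc m) v = begin
    ∑[ u < n ] ∑[ x < n ] (A u x * walks m x v)
      ≡⟨ ∑-comm (λ u x → A u x * walks m x v) ⟩
    ∑[ x < n ] ∑[ u < n ] (A u x * walks m x v)
      ≡⟨ sum-cong-≗ (λ x → *-distribʳ-sum (walks m x v) (λ u → A u x)) ⟨
    ∑[ x < n ] (∑[ u < n ] A u x * walks m x v)
      ≡⟨ sum-cong-≗ (λ x → cong (_* walks m x v) (column-degree x)) ⟩
    ∑[ x < n ] (k * walks m x v)
      ≡⟨ *-distribˡ-sum k (λ x → walks m x v) ⟨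
    k * ∑[ x < n ] walks m x v
      ≡⟨ cong (k *_) (column-sum regular m v) ⟩
    k * k ^ m
      ∎
    where
    column-degree : ∀ x → ∑[ u < n ] A u x ≡ k
    column-degree x = trans (sum-cong-≗ λ u → A-sym u x) (regular x)

record IsFriendship {n : ℕ} (G : Graph n) : Set where
  field
    common-neighbour : ∀ {u v} → ¬ u ≡ v → ∃ λ w → u ∼[ G ] w × w ∼[ G ] v
    common-neighbour-unique : ∀ {u v w w′} → ¬ u ≡ v →
      u ∼[ G ] w → w ∼[ G ] v → u ∼[ G ] w′ → w′ ∼[ G ] v → w ≡ w′

isFriendship : ∀ {n} {G : Graph n} → C4Free G → (∀ u v → DistLe2 G u v) →
               (∀ u v → u ∼[ G ] v → InTriangle G u v) → IsFriendship G
isFriendship {G = G} c4-free distance≤2 triangle = record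
  { common-neighbour = common-neighbour
  ; common-neighbour-unique = common-neighbour-unique
  }
  where
  open Adjacency G using (~-sym; C4Free⇒no-4-cycle)
  common-neighbour : ∀ {u v} → ¬ u ≡ v → ∃ λ w → u ∼[ G ] w × w ∼[ G ] v
  common-neighbour {u} {v} u≢v with distance≤2 u v
  ... | inj₁ u≡v = contradiction u≡v u≢v
  ... | inj₂ (inj₂ path) = path
  ... | inj₂ (inj₁ u~v) with triangle u v u~v
  ...   | w , u~w , v~w = w , u~w , ~-sym v~w
  common-neighbour-unique : ∀ {u v w w′} → ¬ u ≡ v →
    u ∼[ G ] w → w ∼[ G ] v → u ∼[ G ] w′ → w′ ∼[ G ] v → w ≡ w′
  common-neighbour-unique {w = w} {w′} u≢v u~w w~v u~w′ w′~v with w ≟ w′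
  ... | yes w≡w′ = w≡w′
  ... | no w≢w′ = ⊥-elim (C4Free⇒no-4-cycle c4-free u~w w~v (~-sym w′~v) (~-sym u~w′) u≢v w≢w′)

module Friendship {n : ℕ} {G : Graph n} (friendship : IsFriendship G) where
  open IsFriendship friendship
  open Adjacency G
  open Walks G
  open import Data.Nat using (_^_)
  open ≡-Reasoning

  walks-2-≢ : ∀ {u v} → ¬ u ≡ v → walks 2 u v ≡ 1
  walks-2-≢ {u} {v} u≢v with common-neighbour u≢v
  ... | w , u~w , w~v = begin
    ∑[ x < n ] (A u x * walks 1 x v)
      ≡⟨ sum-single _ w off ⟩
    A u w * walks 1 w v
      ≡⟨ cong₂ _*_ ([yes] (u ~? w) u~w) (trans (walks-1 w v) ([yes] (w ~? v) w~v)) ⟩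
    1
      ∎
    where
    off : ∀ x → ¬ x ≡ w → A u x * walks 1 x v ≡ 0
    off x x≢w with u ~? x
    ... | no ¬u~x = refl
    ... | yes u~x = cong (1 *_) (trans (walks-1 x v) ([no] (x ~? v) ¬x~v))
      where
      ¬x~v : ¬ x ~ v
      ¬x~v x~v = x≢w (common-neighbour-unique u≢v u~x x~v u~w w~v)

  walks-2-diag : ∀ u → walks 2 u u ≡ degree u
  walks-2-diag u = sum-cong-≗ λ x →
    trans (cong (A u x *_) (trans (walks-1 x u) (A-sym x u))) ([*]-idem (u ~? x))

  degree≡walks-3 : ∀ {u v} → ¬ u ~ v → degree u ≡ walks 3 u v
  degree≡walks-3 {u} {v} ¬u~v = sum-cong-≗ path
    where
    path : ∀ w → A u w ≡ A u w * walks 2 w v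
    path w with w ≟ v
    ... | yes refl = trans ([no] (u ~? w) ¬u~v) (sym (cong (_* walks 2 w w) ([no] (u ~? w) ¬u~v)))
    ... | no w≢v = sym (trans (cong (A u w *_) (walks-2-≢ w≢v)) (*-identityʳ (A u w)))

  degree-≁ : ∀ {u v} → ¬ u ~ v → degree u ≡ degree v
  degree-≁ {u} {v} ¬u~v = begin
    degree u     ≡⟨ degree≡walks-3 ¬u~v ⟩
    walks 3 u v  ≡⟨ walks-sym 3 u v ⟩
    walks 3 v u  ≡⟨ degree≡walks-3 (¬u~v ∘ ~-sym) ⟨
    degree v     ∎

  module _ (no-dominating : ∀ v → ¬ Dominating G v) where

    regular : ∀ u v → degree u ≡ degree v
    regular u v with u ~? v
    ... | no ¬u~v = degree-≁ ¬u~v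
    ... | yes u~v with non-neighbour (no-dominating u)
    ...   | y , y≢u , ¬u~y with y ~? v
    ...     | no ¬y~v = trans (degree-≁ ¬u~y) (degree-≁ ¬y~v)
    ...     | yes y~v with non-neighbour (no-dominating v)
    ...       | z , z≢v , ¬v~z with z ~? u
    ...         | no ¬z~u = sym (trans (degree-≁ ¬v~z) (degree-≁ ¬z~u))
    ...         | yes z~u with y ~? z
    ...           | no ¬y~z = trans (degree-≁ ¬u~y) (trans (degree-≁ ¬y~z) (sym (degree-≁ ¬v~z)))
    ...           | yes y~z = contradiction v≡z (z≢v ∘ sym)
      where
      -- v and z would be two common neighbours of u and y
      v≡z : v ≡ z
      v≡z = common-neighbour-unique (y≢u ∘ sym) u~v (~-sym y~v) (~-sym z~u) (~-sym y~z)

    module _ (u₀ : Fin n) where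

      k : ℕ
      k = degree u₀

      degree≡k : ∀ u → degree u ≡ k
      degree≡k u = regular u u₀

      -- The identity A² = J + (k - 1) I, applied to a vector X, without subtraction.
      A²-action : ∀ u (X : Fin n → ℕ) → ∑[ w < n ] (walks 2 u w * X w) + X u ≡ sum X + k * X u
      A²-action u X = begin
        ∑[ w < n ] (walks 2 u w * X w) + X u
          ≡⟨ cong (∑[ w < n ] (walks 2 u w * X w) +_) (sum-δ u X) ⟨
        ∑[ w < n ] (walks 2 u w * X w) + ∑[ w < n ] ([ u ≟ w ] * X w)
          ≡⟨ ∑-distrib-+ (λ w → walks 2 u w * X w) (λ w → [ u ≟ w ] * X w) ⟨
        ∑[ w < n ] (walks 2 u w * X w + [ u ≟ w ] * X w)
          ≡⟨ sum-cong-≗ entry ⟩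
        ∑[ w < n ] (X w + [ u ≟ w ] * (k * X w))
          ≡⟨ ∑-distrib-+ X (λ w → [ u ≟ w ] * (k * X w)) ⟩
        sum X + ∑[ w < n ] ([ u ≟ w ] * (k * X w))
          ≡⟨ cong (sum X +_) (sum-δ u (λ w → k * X w)) ⟩
        sum X + k * X u
          ∎
        where
        identity : ∀ k x → k * x + 1 * x ≡ x + 1 * (k * x)
        identity = solve-∀
        entry : ∀ w → walks 2 u w * X w + [ u ≟ w ] * X w ≡ X w + [ u ≟ w ] * (k * X w)
        entry w with u ≟ w
        ... | yes refl =
          trans (cong (λ d → d * X u + 1 * X u) (trans (walks-2-diag u) (degree≡k u))) (identity k (X u))
        ... | no u≢w = trans (cong (λ d → d * X w + 0) (walks-2-≢ u≢w)) (cong (_+ 0) (*-identityˡ (X w)))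

      k*k+1≡n+k : k * k + 1 ≡ n + k
      k*k+1≡n+k = begin
        k * k + 1
          ≡⟨ cong (_+ 1) row-sum ⟨
        ∑[ w < n ] (walks 2 u₀ w * 1) + 1
          ≡⟨ A²-action u₀ (λ _ → 1) ⟩
        ∑[ w < n ] 1 + k * 1
          ≡⟨ cong₂ _+_ (trans (sum-const n 1) (*-identityʳ n)) (*-identityʳ k) ⟩
        n + k
          ∎
        where
        row-sum : ∑[ w < n ] (walks 2 u₀ w * 1) ≡ k * k
        row-sum = trans (sum-cong-≗ λ w → trans (*-identityʳ _) (walks-sym 2 u₀ w))
                        (trans (column-sum degree≡k 2 u₀) (cong (k *_) (*-identityʳ k)))

      2+k≤n : 2 + k ≤ n
      2+k≤n with non-neighbour (no-dominating u₀)
      ... | y , y≢u₀ , ¬u₀~y =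
        sum+2≤size (A u₀) (λ v → [≤1] (u₀ ~? v)) (y≢u₀ ∘ sym) (A-irrefl u₀) ([no] (u₀ ~? y) ¬u₀~y)

      diagonal-≡1[mod] : ∀ {p} → Prime p → k ≡1[mod p ] → ∀ u → walks p u u ≡1[mod p ]
      diagonal-≡1[mod] {zero} p-prime _ _ = contradiction p-prime ¬prime[0]
      diagonal-≡1[mod] {suc zero} p-prime _ _ = contradiction p-prime ¬prime[1]
      diagonal-≡1[mod] {suc (suc m)} _ k≡1 u = ≡1[mod]-cancel step (^-≡1[mod] k≡1 m) k≡1
        where
        step : walks (2 + m) u u + walks m u u ≡ k ^ m + k * walks m u u
        step = begin
          walks (2 + m) u u + walks m u u
            ≡⟨ cong (_+ walks m u u) (walks-+ 2 m u u) ⟩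
          ∑[ w < n ] (walks 2 u w * walks m w u) + walks m u u
            ≡⟨ A²-action u (λ w → walks m w u) ⟩
          ∑[ w < n ] walks m w u + k * walks m u u
            ≡⟨ cong (_+ k * walks m u u) (column-sum degree≡k m u) ⟩
          k ^ m + k * walks m u u
            ∎

      no-dominating⇒empty : ⊥
      no-dominating⇒empty with degree-decomposition k*k+1≡n+k 2+k≤n
      ... | k′ , k≡1+k′ , 2≤k′ , n≡1+k′k with ∃-prime-∣ 2≤k′
      ...   | p , p-prime , divides c k′≡cp =
        ≡1[mod]⇒∤ p-prime (sum-≡1[mod] n≡1 _ (diagonal-≡1[mod] p-prime k≡1)) (prime-∣-trace p-prime)
        where
        identity : ∀ c p k → 1 + c * p * k ≡ 1 + c * k * p
        identity = solve-∀
        k≡1 : k ≡1[mod p ]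
        k≡1 = c , trans k≡1+k′ (cong suc k′≡cp)
        n≡1 : n ≡1[mod p ]
        n≡1 = c * k , trans n≡1+k′k (trans (cong (λ t → 1 + t * k) k′≡cp) (identity c p k))

  friendship-theorem : Fin n → ∃ (Dominating G)
  friendship-theorem u₀ with any? dominating?
  ... | yes dominating = dominating
  ... | no ¬dominating = ⊥-elim (no-dominating⇒empty (λ v d → ¬dominating (v , d)) u₀)

open Adjacency using (bare-edge?; ¬bare-edge⇒in-triangle)
open Friendship using (friendship-theorem)

proposition4p1 : (n : ℕ) (G : Graph n) → C4Free G → Diameter2 G
    → (∀ v → ¬ Dominating G v)
    → ∃ λ u → ∃ λ v → u ∼[ G ] v × ¬ InTriangle G u v
proposition4p1 n G c4-free (distance≤2 , u₀ , _) no-dominating with bare-edge? G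
... | yes bare-edge = bare-edge
... | no ¬bare-edge with friendship-theorem friendship u₀
  where
  friendship : IsFriendship G
  friendship = isFriendship {G = G} c4-free distance≤2 (¬bare-edge⇒in-triangle G ¬bare-edge)
...   | v , v-dominating = ⊥-elim (no-dominating v v-dominating)
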